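{- Let $\lambda$ be a nonnesting set partition of $[n]$ and $\mathscr T_\lambda$ the set of tight splices of $\lambda$. Then $\mathscr T_\lambda$ has a maximum element $K$ with respect to inclusion, and \[\mathscr T_\lambda=\{\lambda\sqcup\nu\mid \nu\text{ is a union of elements of }\mathrm{rows}(K)\}.\]
   Context: $[[n]]=\{(i,j):1\le i<j\le n\}$; $(i,j)\preceq(r,s)$ iff $r\le i<j\le s$. A set partition of $[n]$ is $\lambda\subseteq[[n]]$ with no two distinct elements sharing a first coordinate or sharing a second coordinate; nonnesting if no two distinct elements are $\preceq$-comparable. $\uparrow^{2}\lambda=\{(r,s):\exists(i,j)\in\lambda,\ r\le i<j\le s,\ s-r\ge j-i+2\}$. For disjoint set partitions $\lambda,\nu$, $S=\lambda\sqcup\nu$ is a splice of $\lambda$ if (S1) for every $(i,k)\in\nu$ there is $j$, $i<j<k$, with $(i,j)\in\lambda$ or $(j,k)\in\lambda$; (S2) for all $1\le j<k\le n$: there is $i$ with $(i,j)\in\lambda,(i,k)\in\nu$ iff there is $l$ with $(k,l)\in\lambda,(j,l)\in\nu$. A splice is tight if $S\cap\uparrow^2\lambda=\emptyset$. $\mathrm{bind}(S)=\{(i,j,k,l):(i,j),(k,l)\in\lambda,(i,k),(j,l)\in\nu,j<k\}$. The rows of $S$ are the equivalence classes of $\nu$ under the equivalence relation generated by $(i,k)\sim(j,l)$ whenever $(i,j,k,l)\in\mathrm{bind}(S)$; $\mathrm{rows}(S)$ is the set of rows. -}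

module Defs where

open import Level using (0ℓ)
open import Data.Nat using (ℕ; _+_; _∸_; _≤_; _<_)
open import Data.Product using (Σ; Σ-syntax; ∃; ∃-syntax; _×_; _,_)
open import Data.Sum using (_⊎_)
open import Relation.Nullary using (¬_)
open import Relation.Unary using (Pred; _⊆_; _∪_; _≐_; _∈_)
open import Relation.Binary.PropositionalEquality using (_≡_)
open import Relation.Binary.Construct.Closure.Equivalence using (EqClosure)
open import Function.Bundles using (_⇔_)

PairSet : Set₁
PairSet = Pred (ℕ × ℕ) 0ℓ

InArcs : ℕ → ℕ × ℕ → Set
InArcs n (i , j) = 1 ≤ i × i < j × j ≤ n

-- set partition of [n] (as a set of arcs)
SetPartition : ℕ → PairSet → Set
SetPartition n L =
  (∀ {i j} → (i , j) ∈ L → InArcs n (i , j)) ×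
  (∀ {i j k} → (i , j) ∈ L → (i , k) ∈ L → j ≡ k) ×
  (∀ {i j k} → (i , j) ∈ L → (k , j) ∈ L → i ≡ k)

_⪯_ : ℕ × ℕ → ℕ × ℕ → Set
(i , j) ⪯ (r , s) = r ≤ i × i < j × j ≤ s

Nonnesting : PairSet → Set
Nonnesting L = ∀ {x y} → x ∈ L → y ∈ L → x ⪯ y → x ≡ y

Up2 : PairSet → PairSet
Up2 L (r , s) = ∃[ i ] ∃[ j ] ((i , j) ∈ L × r ≤ i × i < j × j ≤ s × (j ∸ i) + 2 ≤ s ∸ r)

Disjoint : PairSet → PairSet → Set
Disjoint A B = ∀ {x} → x ∈ A → x ∈ B → Data.Empty.⊥
  where import Data.Empty

-- S = λ ⊔ ν is a splice of λ (ν is the complementary part, S = λ ∪ ν)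
IsSplice : ℕ → PairSet → PairSet → Set
IsSplice n L N =
  SetPartition n L × SetPartition n N × Disjoint L N ×
  (∀ {i k} → (i , k) ∈ N → ∃[ j ] (i < j × j < k × ((i , j) ∈ L ⊎ (j , k) ∈ L))) ×
  (∀ j k → 1 ≤ j → j < k → k ≤ n →
     ((∃[ i ] ((i , j) ∈ L × (i , k) ∈ N)) ⇔ (∃[ l ] ((k , l) ∈ L × (j , l) ∈ N))))

IsTightSplice : ℕ → PairSet → PairSet → Set
IsTightSplice n L N = IsSplice n L N × (∀ {x} → x ∈ (L ∪ N) → ¬ (x ∈ Up2 L))

InTightSplices : ℕ → PairSet → PairSet → Set₁
InTightSplices n L S = ∃[ N ] (IsTightSplice n L N × S ≐ (L ∪ N))

-- bind(S) for S = λ ⊔ ν, viewed as the generating relation (i,k) ~ (j,l)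
BindStep : PairSet → PairSet → ℕ × ℕ → ℕ × ℕ → Set
BindStep L N (i , k) (j , l) =
  (i , j) ∈ L × (k , l) ∈ L × (i , k) ∈ N × (j , l) ∈ N × j < k

Row : PairSet → PairSet → ℕ × ℕ → PairSet
Row L N y x = EqClosure (BindStep L N) y x

IsUnionOfRows : PairSet → PairSet → PairSet → Set₁
IsUnionOfRows L N N' =
  ∃[ Y ] (Y ⊆ N × N' ≐ (λ x → ∃[ y ] (y ∈ Y × x ∈ Row L N y)))

-- An arc of a tight splice cannot lie in ↑²λ, so its S1 witness forces it to be
-- (i , j + 1) or (j - 1 , k) for an arc (i , j) or (j , k) of λ; with λ nonnesting
-- this makes arcs with the same start (or end) coincide. Condition S2 says that ν is
-- closed, in both directions, under the "linking" step (i , k) ~ (j , l) for arcs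
-- (i , j), (k , l) of λ with j < k. Hence νK, the set of arcs whose whole linking
-- class consists of locally admissible arcs, contains the ν-part of every tight
-- splice, and conversely every subset of νK closed under the binding steps of νK
-- (that is, every union of rows) satisfies S1, S2 and tightness.
module Submission where

open import Defs
open import Data.Nat using (ℕ; zero; suc; _+_; _∸_; _≤_; _<_; s≤s; z≤n; _≤?_)
open import Data.Nat.Properties
open import Data.Product using (Σ-syntax; ∃-syntax; _×_; _,_; proj₁; proj₂)
open import Data.Sum as Sum using (_⊎_; inj₁; inj₂)
open import Data.Empty using (⊥-elim)
open import Function.Base using (flip; id)
open import Function.Bundles using (_⇔_; mk⇔; Equivalence)
open import Relation.Nullary using (yes; no)
open import Relation.Unary using (Pred; _⊆_; _∪_; _≐_; _∈_; _∉_)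
open import Relation.Binary.Core using (Rel)
open import Relation.Binary.Definitions using (_Respects_)
open import Relation.Binary.PropositionalEquality using (_≡_; refl; sym; cong; subst)
open import Relation.Binary.Construct.Closure.Equivalence using (EqClosure)
open import Relation.Binary.Construct.Closure.ReflexiveTransitive using (ε; _◅_; _◅◅_)
open import Relation.Binary.Construct.Closure.Symmetric using (fwd; bwd)

respects-EqClosure : ∀ {a ℓ p} {A : Set a} {R : Rel A ℓ} {Q : Pred A p} →
  Q Respects R → Q Respects flip R → Q Respects EqClosure R
respects-EqClosure f b ε q = q
respects-EqClosure f b (fwd r ◅ s) q = respects-EqClosure f b s (f r q)
respects-EqClosure f b (bwd r ◅ s) q = respects-EqClosure f b s (b r q)

∸-gap-extendʳ : ∀ i j k → i ≤ j → 2 + j ≤ k → (j ∸ i) + 2 ≤ k ∸ i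
∸-gap-extendʳ zero j k _ 2+j≤k = subst (_≤ k) (+-comm 2 j) 2+j≤k
∸-gap-extendʳ (suc i) (suc j) (suc k) (s≤s i≤j) (s≤s 2+j≤k) = ∸-gap-extendʳ i j k i≤j 2+j≤k

∸-gap-extendˡ : ∀ i j k → 2 + i ≤ j → j ≤ k → (k ∸ j) + 2 ≤ k ∸ i
∸-gap-extendˡ zero j k 2≤j j≤k = subst ((k ∸ j) + 2 ≤_) (m∸n+n≡m j≤k) (+-monoʳ-≤ (k ∸ j) 2≤j)
∸-gap-extendˡ (suc i) (suc j) (suc k) (s≤s 2+i≤j) (s≤s j≤k) = ∸-gap-extendˡ i j k 2+i≤j j≤k

1≤end : ∀ {n i j} → InArcs n (i , j) → 1 ≤ j
1≤end (1≤i , i<j , _) = ≤-trans 1≤i (<⇒≤ i<j)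

start≤n : ∀ {n i j} → InArcs n (i , j) → i ≤ n
start≤n (_ , i<j , j≤n) = <⇒≤ (<-≤-trans i<j j≤n)

Spliced : PairSet → ℕ × ℕ → Set
Spliced L (i , k) = ∃[ j ] (i < j × j < k × ((i , j) ∈ L ⊎ (j , k) ∈ L))

-- The two halves of S2, as demanded of a single arc of ν.
ExtensibleRight : PairSet → ℕ × ℕ → Set
ExtensibleRight L (i , k) = ∀ {j} → (i , j) ∈ L → j < k → ∃[ l ] ((k , l) ∈ L)

ExtensibleLeft : PairSet → ℕ × ℕ → Set
ExtensibleLeft L (j , l) = ∀ {k} → (k , l) ∈ L → j < k → ∃[ i ] ((i , j) ∈ L)

Links : PairSet → ℕ × ℕ → ℕ × ℕ → Set
Links L (i , k) (j , l) = (i , j) ∈ L × (k , l) ∈ L × j < k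

BindStep⇒Links : ∀ {L N x y} → BindStep L N x y → Links L x y
BindStep⇒Links {x = _ , _} {y = _ , _} (ij , kl , _ , _ , j<k) = ij , kl , j<k

module _ {L : PairSet} where

  ∉Up2⇒suc-end : ∀ {i j k} → (i , j) ∈ L → i < j → j < k → (i , k) ∉ Up2 L → k ≡ suc j
  ∉Up2⇒suc-end {i} {j} {k} ij i<j j<k ik∉ with k ≤? suc j
  ... | yes k≤1+j = ≤-antisym k≤1+j j<k
  ... | no k≰1+j = ⊥-elim (ik∉ (i , j , ij , ≤-refl , i<j , <⇒≤ j<k ,
                      ∸-gap-extendʳ i j k (<⇒≤ i<j) (≰⇒> k≰1+j)))

  ∉Up2⇒suc-start : ∀ {i j k} → (j , k) ∈ L → i < j → j < k → (i , k) ∉ Up2 L → j ≡ suc i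
  ∉Up2⇒suc-start {i} {j} {k} jk i<j j<k ik∉ with j ≤? suc i
  ... | yes j≤1+i = ≤-antisym j≤1+i i<j
  ... | no j≰1+i = ⊥-elim (ik∉ (j , k , jk , <⇒≤ i<j , j<k , ≤-refl ,
                      ∸-gap-extendˡ i j k (≰⇒> j≰1+i) (<⇒≤ j<k)))

  spliced-∉Up2⇒adjacent : ∀ {i k} → Spliced L (i , k) → (i , k) ∉ Up2 L →
    (∃[ j ] ((i , j) ∈ L × i < j × k ≡ suc j)) ⊎ ((suc i , k) ∈ L)
  spliced-∉Up2⇒adjacent (j , i<j , j<k , inj₁ ij) ik∉ =
    inj₁ (j , ij , i<j , ∉Up2⇒suc-end ij i<j j<k ik∉)
  spliced-∉Up2⇒adjacent (j , i<j , j<k , inj₂ jk) ik∉ with ∉Up2⇒suc-start jk i<j j<k ik∉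
  ... | refl = inj₂ jk

  module _ (nonnesting : Nonnesting L) where

    nonnesting⇒∉Up2 : ∀ {x} → x ∈ L → x ∉ Up2 L
    nonnesting⇒∉Up2 {r , s} rs (i , j , ij , r≤i , i<j , j≤s , gap)
      with nonnesting ij rs (r≤i , i<j , j≤s)
    ... | refl = <-irrefl refl (<-≤-trans (m<m+n (j ∸ i) (s≤s z≤n)) gap)

    nonnesting-end< : ∀ {i j k} → (i , j) ∈ L → (suc i , k) ∈ L → suc i < k → j < k
    nonnesting-end< {i} {j} {k} ij ik 1+i<k with k ≤? j
    ... | no k≰j = ≰⇒> k≰j
    ... | yes k≤j with nonnesting ik ij (n≤1+n i , 1+i<k , k≤j)
    ... | ()

    nonnesting-start< : ∀ {i j h} → (i , j) ∈ L → (h , suc j) ∈ L → i < j → i < h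
    nonnesting-start< {i} {j} {h} ij hj i<j with h ≤? i
    ... | no h≰i = ≰⇒> h≰i
    ... | yes h≤i = ⊥-elim (<-irrefl (cong proj₂ (nonnesting ij hj (h≤i , i<j , n≤1+n j))) (n<1+n j))

module Maximal {n : ℕ} {L : PairSet} (partition : SetPartition n L) (nonnesting : Nonnesting L) where

  inArcsL : ∀ {i j} → (i , j) ∈ L → InArcs n (i , j)
  inArcsL = proj₁ partition

  endL-unique : ∀ {i j k} → (i , j) ∈ L → (i , k) ∈ L → j ≡ k
  endL-unique = proj₁ (proj₂ partition)

  startL-unique : ∀ {i j k} → (i , j) ∈ L → (k , j) ∈ L → i ≡ k
  startL-unique = proj₂ (proj₂ partition)

  record Admissible (x : ℕ × ℕ) : Set where
    field
      inArcs      : InArcs n x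
      ∉L          : x ∉ L
      ∉Up2        : x ∉ Up2 L
      spliced     : Spliced L x
      extensibleʳ : ExtensibleRight L x
      extensibleˡ : ExtensibleLeft L x

  open Admissible

  νK : PairSet
  νK x = ∀ {y} → EqClosure (Links L) x y → Admissible y

  νK⇒admissible : νK ⊆ Admissible
  νK⇒admissible x∈νK = x∈νK ε

  νK-respects-Links : νK Respects Links L
  νK-respects-Links xy x∈νK yz = x∈νK (fwd xy ◅ yz)

  νK-respects-flip-Links : νK Respects flip (Links L)
  νK-respects-flip-Links yx x∈νK yz = x∈νK (bwd yx ◅ yz)

  νK-respects-rows : νK Respects EqClosure (BindStep L νK)
  νK-respects-rows = respects-EqClosure
    (λ { {_ , _} {_ , _} (_ , _ , _ , y∈νK , _) _ → y∈νK })
    (λ { {_ , _} {_ , _} (_ , _ , y∈νK , _ , _) _ → y∈νK })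

  private
    adjacent : ∀ {i k} → Admissible (i , k) →
      (∃[ j ] ((i , j) ∈ L × i < j × k ≡ suc j)) ⊎ ((suc i , k) ∈ L)
    adjacent a = spliced-∉Up2⇒adjacent (spliced a) (∉Up2 a)

    mixed-end : ∀ {i j k} → (i , j) ∈ L → i < j → (suc i , k) ∈ L → Admissible (i , k) → k ≡ suc j
    mixed-end ij i<j ik a = ∉Up2⇒suc-end ij i<j (nonnesting-end< nonnesting ij ik (proj₁ (proj₂ (inArcsL ik)))) (∉Up2 a)

    mixed-start : ∀ {i i' j} → (i , j) ∈ L → i < j → (suc i' , suc j) ∈ L → Admissible (i , suc j) → i ≡ i'
    mixed-start ij i<j i'j a = suc-injective (sym (∉Up2⇒suc-start i'j
      (nonnesting-start< nonnesting ij i'j i<j) (proj₁ (proj₂ (inArcsL i'j))) (∉Up2 a)))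

  admissible-end-unique : ∀ {i k k'} → Admissible (i , k) → Admissible (i , k') → k ≡ k'
  admissible-end-unique a a' with adjacent a | adjacent a'
  ... | inj₁ (j , ij , _ , refl) | inj₁ (j' , ij' , _ , refl) = cong suc (endL-unique ij ij')
  ... | inj₁ (j , ij , i<j , refl) | inj₂ ik' = sym (mixed-end ij i<j ik' a')
  ... | inj₂ ik | inj₁ (j' , ij' , i<j' , refl) = mixed-end ij' i<j' ik a
  ... | inj₂ ik | inj₂ ik' = endL-unique ik ik'

  admissible-start-unique : ∀ {i i' k} → Admissible (i , k) → Admissible (i' , k) → i ≡ i'
  admissible-start-unique a a' with adjacent a | adjacent a'
  ... | inj₁ (j , ij , _ , refl) | inj₁ (j' , i'j' , _ , e) with suc-injective e
  ...   | refl = startL-unique ij i'j'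
  admissible-start-unique a a' | inj₁ (j , ij , i<j , refl) | inj₂ i'k = mixed-start ij i<j i'k a
  admissible-start-unique a a' | inj₂ ik | inj₁ (j' , i'j' , i<j' , refl) = sym (mixed-start i'j' i<j' ik a')
  admissible-start-unique a a' | inj₂ ik | inj₂ i'k = suc-injective (startL-unique ik i'k)

  module _ {N : PairSet} (tight : IsTightSplice n L N) where

    private
      inArcsN : ∀ {i j} → (i , j) ∈ N → InArcs n (i , j)
      inArcsN = proj₁ (proj₁ (proj₂ (proj₁ tight)))

      disjointN : Disjoint L N
      disjointN = proj₁ (proj₂ (proj₂ (proj₁ tight)))

      S1 : ∀ {i k} → (i , k) ∈ N → Spliced L (i , k)
      S1 = proj₁ (proj₂ (proj₂ (proj₂ (proj₁ tight))))

      S2 : ∀ j k → 1 ≤ j → j < k → k ≤ n →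
        ((∃[ i ] ((i , j) ∈ L × (i , k) ∈ N)) ⇔ (∃[ l ] ((k , l) ∈ L × (j , l) ∈ N)))
      S2 = proj₂ (proj₂ (proj₂ (proj₂ (proj₁ tight))))

    tight-respects-Links : N Respects Links L
    tight-respects-Links {i , k} {j , l} (ij , kl , j<k) ik
      with Equivalence.to (S2 j k (1≤end (inArcsL ij)) j<k (proj₂ (proj₂ (inArcsN ik)))) (i , ij , ik)
    ... | l' , kl' , jl' with endL-unique kl kl'
    ... | refl = jl'

    tight-respects-flip-Links : N Respects flip (Links L)
    tight-respects-flip-Links {j , l} {i , k} (ij , kl , j<k) jl
      with Equivalence.from (S2 j k (proj₁ (inArcsN jl)) j<k (start≤n (inArcsL kl))) (l , kl , jl)
    ... | i' , i'j , i'k with startL-unique ij i'j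
    ... | refl = i'k

    tight⇒admissible : N ⊆ Admissible
    tight⇒admissible {a , b} ab = record
      { inArcs      = inArcsN ab
      ; ∉L          = λ ab∈L → disjointN ab∈L ab
      ; ∉Up2        = proj₂ tight (inj₂ ab)
      ; spliced     = S1 ab
      ; extensibleʳ = right
      ; extensibleˡ = left
      }
      where
      right : ∀ {j} → (a , j) ∈ L → j < b → ∃[ l ] ((b , l) ∈ L)
      right {j} aj j<b with Equivalence.to (S2 j b (1≤end (inArcsL aj)) j<b (proj₂ (proj₂ (inArcsN ab)))) (a , aj , ab)
      ... | l , bl , _ = l , bl
      left : ∀ {k} → (k , b) ∈ L → a < k → ∃[ i ] ((i , a) ∈ L)
      left {k} kb a<k with Equivalence.from (S2 a k (proj₁ (inArcsN ab)) a<k (start≤n (inArcsL kb))) (b , kb , ab)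
      ... | i , ia , _ = i , ia

    tight⊆νK : N ⊆ νK
    tight⊆νK x∈N xy = tight⇒admissible (respects-EqClosure tight-respects-Links tight-respects-flip-Links xy x∈N)

    tight-respects-rows : N Respects EqClosure (BindStep L νK)
    tight-respects-rows = respects-EqClosure
      (λ s → tight-respects-Links (BindStep⇒Links {L} {νK} s))
      (λ s → tight-respects-flip-Links (BindStep⇒Links {L} {νK} s))

    tight⇒unionOfRows : IsUnionOfRows L νK N
    tight⇒unionOfRows = N , tight⊆νK , (λ x∈N → _ , x∈N , ε) , λ (_ , y∈N , row) → tight-respects-rows row y∈N

  closed⇒tight : ∀ {N} → N ⊆ νK → N Respects EqClosure (BindStep L νK) → IsTightSplice n L N
  closed⇒tight {N} N⊆νK closed = (partition , partitionN , disjoint , S1 , S2) , notUp2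
    where
    admissibleN : N ⊆ Admissible
    admissibleN x∈N = νK⇒admissible (N⊆νK x∈N)

    partitionN : SetPartition n N
    partitionN = (λ x∈N → inArcs (admissibleN x∈N))
               , (λ ij ik → admissible-end-unique (admissibleN ij) (admissibleN ik))
               , (λ ij kj → admissible-start-unique (admissibleN ij) (admissibleN kj))

    disjoint : Disjoint L N
    disjoint x∈L x∈N = ∉L (admissibleN x∈N) x∈L

    S1 : ∀ {i k} → (i , k) ∈ N → Spliced L (i , k)
    S1 x∈N = spliced (admissibleN x∈N)

    S2 : ∀ j k → 1 ≤ j → j < k → k ≤ n →
      ((∃[ i ] ((i , j) ∈ L × (i , k) ∈ N)) ⇔ (∃[ l ] ((k , l) ∈ L × (j , l) ∈ N)))
    S2 j k _ j<k _ = mk⇔ to from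
      where
      to : ∃[ i ] ((i , j) ∈ L × (i , k) ∈ N) → ∃[ l ] ((k , l) ∈ L × (j , l) ∈ N)
      to (i , ij , ik) with extensibleʳ (admissibleN ik) ij j<k
      ... | l , kl = l , kl , closed (fwd (ij , kl , N⊆νK ik , jl∈νK , j<k) ◅ ε) ik
        where jl∈νK = νK-respects-Links (ij , kl , j<k) (N⊆νK ik)
      from : ∃[ l ] ((k , l) ∈ L × (j , l) ∈ N) → ∃[ i ] ((i , j) ∈ L × (i , k) ∈ N)
      from (l , kl , jl) with extensibleˡ (admissibleN jl) kl j<k
      ... | i , ij = i , ij , closed (bwd (ij , kl , ik∈νK , N⊆νK jl , j<k) ◅ ε) jl
        where ik∈νK = νK-respects-flip-Links (ij , kl , j<k) (N⊆νK jl)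

    notUp2 : ∀ {x} → x ∈ (L ∪ N) → x ∉ Up2 L
    notUp2 (inj₁ x∈L) = nonnesting⇒∉Up2 nonnesting x∈L
    notUp2 (inj₂ x∈N) = ∉Up2 (admissibleN x∈N)

  νK-tight : IsTightSplice n L νK
  νK-tight = closed⇒tight id νK-respects-rows

  unionOfRows⇒tight : ∀ {N} → IsUnionOfRows L νK N → IsTightSplice n L N
  unionOfRows⇒tight {N} (Y , Y⊆νK , N≐rows) = closed⇒tight N⊆νK N-respects-rows
    where
    N⊆νK : N ⊆ νK
    N⊆νK x∈N with proj₁ N≐rows x∈N
    ... | y , y∈Y , row = νK-respects-rows row (Y⊆νK y∈Y)

    N-respects-rows : N Respects EqClosure (BindStep L νK)
    N-respects-rows xz x∈N with proj₁ N≐rows x∈N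
    ... | y , y∈Y , row = proj₂ N≐rows (y , y∈Y , row ◅◅ xz)

proposition3p4 : (n : ℕ) (L : PairSet) → SetPartition n L → Nonnesting L →
    Σ[ NK ∈ PairSet ]
      ( IsTightSplice n L NK
      × (∀ S → InTightSplices n L S → S ⊆ (L ∪ NK))
      × (∀ S → InTightSplices n L S ⇔ (∃[ N ] (IsUnionOfRows L NK N × S ≐ (L ∪ N)))))
proposition3p4 n L partition nonnesting = νK , νK-tight , maximum , characterisation
  where
  open Maximal partition nonnesting

  maximum : ∀ S → InTightSplices n L S → S ⊆ (L ∪ νK)
  maximum S (N , tight , S≐) x∈S = Sum.map₂ (tight⊆νK tight) (proj₁ S≐ x∈S)

  characterisation : ∀ S → InTightSplices n L S ⇔ (∃[ N ] (IsUnionOfRows L νK N × S ≐ (L ∪ N)))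
  characterisation S = mk⇔
    (λ (N , tight , S≐) → N , tight⇒unionOfRows tight , S≐)
    (λ (N , rows , S≐) → N , unionOfRows⇒tight rows , S≐)
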